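{- Let $\widetilde{G}$ be a mixed graph whose underlying graph $G$ has pairwise vertex-disjoint cycles and satisfies $m(T_G)=m([T_G])$. Then no vertex lying on a mixed cycle of $\widetilde{G}$ is a quasi-pendant vertex of $\widetilde{G}$.
   Context: A mixed graph $\widetilde{G}$ is obtained from a simple graph $G$ by orienting some edges; a mixed cycle is a cycle of $G$ (with the induced orientations). $m(\cdot)$ denotes the matching number. A pendant vertex is a vertex of degree one in $G$; a quasi-pendant vertex is a vertex adjacent to a pendant vertex. For a graph $G$ whose cycles are pairwise vertex-disjoint, $T_G$ is obtained from $G$ by contracting each cycle into a single vertex (a contracted vertex), and $[T_G]$ is obtained from $T_G$ by deleting all contracted vertices and their incident edges. -}

module Defs where

open import Data.Nat using (ℕ; zero; suc; _≤_; _+_)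
open import Data.Fin using (Fin; zero; suc; inject₁; fromℕ)
open import Data.Bool using (Bool; true; false; if_then_else_)
open import Data.List using (List; []; _∷_; length; map; concatMap; allFin)
open import Data.Nat.ListAction using (sum)
open import Data.Unit using (⊤)
open import Data.List.Relation.Unary.All using (All)
open import Data.List.Relation.Unary.Unique.Propositional using (Unique)
open import Data.Product using (Σ; ∃; ∃-syntax; _×_; _,_)
open import Data.Sum using (_⊎_)
open import Relation.Binary.PropositionalEquality using (_≡_; _≢_)
open import Relation.Nullary using (¬_)
open import Function.Bundles using (_⇔_)
open import Function.Definitions using (Injective)

record Graph (n : ℕ) : Set where
  field
    adj    : Fin n → Fin n → Bool
    sym    : ∀ u v → adj u v ≡ adj v u
    irrefl : ∀ v → adj v v ≡ false

open Graph public

Adj : ∀ {n} → Graph n → Fin n → Fin n → Set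
Adj G u v = adj G u v ≡ true

-- Mixed graph: an underlying simple graph with some edges oriented.
-- arc u v = true means the edge uv is oriented from u to v.
record MixedGraph (n : ℕ) : Set where
  field
    underlying : Graph n
    arc        : Fin n → Fin n → Bool
    arc-edge   : ∀ u v → arc u v ≡ true → Adj underlying u v
    arc-single : ∀ u v → arc u v ≡ true → arc v u ≡ false

open MixedGraph public

degree : ∀ {n} → Graph n → Fin n → ℕ
degree {n} G v = sum (map (λ u → if adj G v u then 1 else 0) (allFin n))

Pendant : ∀ {n} → Graph n → Fin n → Set
Pendant G v = degree G v ≡ 1

QuasiPendant : ∀ {n} → Graph n → Fin n → Set
QuasiPendant G v = ∃[ u ] (Adj G v u × Pendant G u)

-- Cycles: vertices vs 0, vs 1, ..., vs k (k ≥ 2, so length ≥ 3),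
-- pairwise distinct, consecutive ones adjacent, and vs k adjacent to vs 0.

record Cycle {n : ℕ} (G : Graph n) : Set where
  field
    k     : ℕ
    k≥2   : 2 ≤ k
    vs    : Fin (suc k) → Fin n
    inj   : Injective _≡_ _≡_ vs
    step  : ∀ (i : Fin k) → Adj G (vs (inject₁ i)) (vs (suc i))
    close : Adj G (vs (fromℕ k)) (vs zero)

open Cycle public

OnCycle : ∀ {n} {G : Graph n} → Cycle G → Fin n → Set
OnCycle C v = ∃[ i ] (vs C i ≡ v)

SamePair : ∀ {n} → Fin n → Fin n → Fin n → Fin n → Set
SamePair u v a b = (u ≡ a × v ≡ b) ⊎ (u ≡ b × v ≡ a)

CycEdge : ∀ {n} {G : Graph n} → Cycle G → Fin n → Fin n → Set
CycEdge C u v =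
  (∃[ i ] SamePair u v (vs C (inject₁ i)) (vs C (suc i)))
  ⊎ SamePair u v (vs C (fromℕ (k C))) (vs C zero)

-- Any two cycles of G are either the same cycle (same edge set) or
-- vertex-disjoint.
CyclesVertexDisjoint : ∀ {n} → Graph n → Set
CyclesVertexDisjoint G =
  ∀ (C D : Cycle G) → (∃[ v ] (OnCycle C v × OnCycle D v)) →
  ∀ u v → CycEdge C u v ⇔ CycEdge D u v

-- T_G: the graph obtained from G by contracting each cycle into a single
-- vertex, given as a quotient graph T on Fin m with the quotient map φ.
-- φ identifies exactly the vertices lying on a common cycle; two vertices
-- of T are adjacent iff they are distinct and some edge of G joins their
-- preimages.

record CycleContraction {n : ℕ} (G : Graph n) : Set where
  field
    m      : ℕ
    T      : Graph m
    φ      : Fin n → Fin m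
    φ-surj : ∀ a → ∃[ u ] (φ u ≡ a)
    φ-fib  : ∀ u v → (φ u ≡ φ v) ⇔ (u ≡ v ⊎ ∃[ C ] (OnCycle {G = G} C u × OnCycle C v))
    T-adj  : ∀ a b → Adj T a b ⇔
             (a ≢ b × ∃[ u ] ∃[ v ] (φ u ≡ a × φ v ≡ b × Adj G u v))

open CycleContraction public

Contracted : ∀ {n} {G : Graph n} (TG : CycleContraction G) → Fin (m TG) → Set
Contracted {G = G} TG a = ∃[ C ] ∃[ u ] (OnCycle {G = G} C u × φ TG u ≡ a)

-- Matchings and matching number of the subgraph of H induced by the
-- vertex set P.  (For P = everything this is m(H); [T_G] is the subgraph
-- of T_G induced by the non-contracted vertices.)

endpoints : ∀ {m} → List (Fin m × Fin m) → List (Fin m)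
endpoints = concatMap (λ { (u , v) → u ∷ v ∷ [] })

IsMatching : ∀ {m} → Graph m → (Fin m → Set) → List (Fin m × Fin m) → Set
IsMatching H P M =
  All (λ { (u , v) → Adj H u v × P u × P v }) M × Unique (endpoints M)

MatchingNumber : ∀ {m} → Graph m → (Fin m → Set) → ℕ → Set
MatchingNumber H P t =
  (∃[ M ] (IsMatching H P M × length M ≡ t)) ×
  (∀ M → IsMatching H P M → length M ≤ t)

Everything : ∀ {m} → Fin m → Set
Everything _ = ⊤

module Submission where

-- Suppose v lies on a cycle C of G and is adjacent to a
-- pendant vertex u.  A pendant vertex has exactly one neighbour, while every
-- cycle vertex has two distinct neighbours, so u lies on no cycle; hence the
-- contraction map φ : G → T_G has the singleton fibre {u} over b = φ u, and
-- the only T_G-neighbour of b is the contracted vertex c = φ v.  Consequently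
-- a maximum matching of [T_G] (which avoids contracted vertices) meets
-- neither b nor c and extends by the edge bc to a matching of T_G, so
-- m(T_G) > m([T_G]), contradicting the hypothesis.

open import Defs
open import Data.Nat using (ℕ; zero; suc; _≤_; _+_; s≤s)
open import Data.Nat.Properties using (≤-trans; m≤m+n; m≤n+m; +-comm; +-monoʳ-≤; n≮n)
open import Data.Fin using (Fin; zero; suc; inject₁; fromℕ)
open import Data.Fin.Properties using (_≟_; suc-injective)
open import Data.Bool using (if_then_else_)
open import Data.List using (List; []; _∷_; length; tabulate)
open import Data.List.Properties using (map-tabulate)
open import Data.Nat.ListAction using (sum)
open import Data.List.Relation.Unary.All as All using (All; []; _∷_)
open import Data.List.Relation.Unary.AllPairs using (_∷_)
open import Data.Product using (∃-syntax; _×_; _,_; proj₁; proj₂)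
open import Data.Sum using (inj₁; inj₂)
open import Data.Unit using (tt)
open import Data.Empty using (⊥; ⊥-elim)
open import Relation.Nullary using (¬_; yes; no)
open import Relation.Binary.PropositionalEquality as ≡
  using (_≡_; refl; _≢_; trans; cong; subst)
open import Function.Bundles using (Equivalence)

private
  variable
    n : ℕ

adj-sym : (G : Graph n) {u v : Fin n} → Adj G u v → Adj G v u
adj-sym G {u} {v} p = trans (Graph.sym G v u) p

adj-irrefl : (G : Graph n) {u v : Fin n} → Adj G u v → u ≢ v
adj-irrefl G {u} p refl with trans (≡.sym (irrefl G u)) p
... | ()

term≤sum : (g : Fin n → ℕ) (a : Fin n) → g a ≤ sum (tabulate g)
term≤sum g zero    = m≤m+n (g zero) _
term≤sum g (suc a) = ≤-trans (term≤sum (λ x → g (suc x)) a) (m≤n+m _ (g zero))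

two-terms≤sum : (g : Fin n → ℕ) (a b : Fin n) → a ≢ b →
                g a + g b ≤ sum (tabulate g)
two-terms≤sum g zero    zero    a≢b = ⊥-elim (a≢b refl)
two-terms≤sum g zero    (suc b) _   = +-monoʳ-≤ (g zero) (term≤sum (λ x → g (suc x)) b)
two-terms≤sum g (suc a) zero    _   =
  subst (_≤ sum (tabulate g)) (+-comm (g zero) (g (suc a)))
        (+-monoʳ-≤ (g zero) (term≤sum (λ x → g (suc x)) a))
two-terms≤sum g (suc a) (suc b) a≢b =
  ≤-trans (two-terms≤sum (λ x → g (suc x)) a b (λ e → a≢b (cong suc e)))
          (m≤n+m _ (g zero))

two-neighbours⇒degree≥2 : (G : Graph n) {u a b : Fin n} → a ≢ b →
                          Adj G u a → Adj G u b → 2 ≤ degree G u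
two-neighbours⇒degree≥2 {n} G {u} {a} {b} a≢b ua ub =
  subst (2 ≤_) sum-is-degree (indicators-are-one (two-terms≤sum indicator a b a≢b))
  where
  indicator : Fin n → ℕ
  indicator x = if adj G u x then 1 else 0

  indicators-are-one : indicator a + indicator b ≤ sum (tabulate indicator) →
                       2 ≤ sum (tabulate indicator)
  indicators-are-one p rewrite ua | ub = p

  sum-is-degree : sum (tabulate indicator) ≡ degree G u
  sum-is-degree = cong sum (≡.sym (map-tabulate (λ x → x) indicator))

pendant-unique-neighbour : (G : Graph n) {u a b : Fin n} → Pendant G u →
                           Adj G u a → Adj G u b → a ≡ b
pendant-unique-neighbour G {a = a} {b} pen ua ub with a ≟ b
... | yes a≡b = a≡b
... | no  a≢b = ⊥-elim (n≮n 1 (subst (2 ≤_) pen (two-neighbours⇒degree≥2 G a≢b ua ub)))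

inject₁²≢suc² : ∀ {m} (x : Fin m) → inject₁ (inject₁ x) ≢ suc (suc x)
inject₁²≢suc² zero    ()
inject₁²≢suc² (suc x) e = inject₁²≢suc² x (suc-injective e)

data LastOrInject {m : ℕ} : Fin (suc m) → Set where
  last   : LastOrInject (fromℕ m)
  inject : (j : Fin m) → LastOrInject (inject₁ j)

lastOrInject : ∀ {m} (j : Fin (suc m)) → LastOrInject j
lastOrInject {zero}  zero    = last
lastOrInject {suc m} zero    = inject zero
lastOrInject {suc m} (suc j) with lastOrInject j
... | last     = last
... | inject j′ = inject (suc j′)

-- The predecessor and successor of a cycle vertex are distinct neighbours
-- (this uses that cycles have length at least three).
cycle-two-neighbours : {G : Graph n} (C : Cycle G) (i : Fin (suc (k C))) →
  ∃[ a ] ∃[ b ] (a ≢ b × Adj G (vs C i) (vs C a) × Adj G (vs C i) (vs C b))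
cycle-two-neighbours {G = G} record { k = suc (suc k′) ; k≥2 = s≤s (s≤s _)
                                    ; step = step ; close = close } zero =
  suc zero , fromℕ (suc (suc k′)) , (λ ()) , step zero , adj-sym G close
cycle-two-neighbours {G = G} record { k = suc (suc k′) ; k≥2 = s≤s (s≤s _)
                                    ; step = step ; close = close } (suc j)
  with lastOrInject j
... | last      = inject₁ (fromℕ (suc k′)) , zero , (λ ()) , adj-sym G (step _) , close
... | inject j′ = inject₁ (inject₁ j′) , suc (suc j′) , inject₁²≢suc² j′
                , adj-sym G (step _) , step (suc j′)

pendant-not-on-cycle : (G : Graph n) {u : Fin n} → Pendant G u →
                       (C : Cycle G) → ¬ OnCycle C u
pendant-not-on-cycle G pen C (i , refl)
  with cycle-two-neighbours C i
... | a , b , a≢b , ua , ub = a≢b (inj C (pendant-unique-neighbour G pen ua ub))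

module _ {G : Graph n} (TG : CycleContraction G)
         {u v : Fin n} (pen : Pendant G u) (uv : Adj G u v) where

  pendant-fibre : ∀ {x} → φ TG x ≡ φ TG u → x ≡ u
  pendant-fibre {x} e with Equivalence.to (φ-fib TG x u) e
  ... | inj₁ x≡u           = x≡u
  ... | inj₂ (C , _ , onC) = ⊥-elim (pendant-not-on-cycle G pen C onC)

  pendant-image-adj : Adj (T TG) (φ TG u) (φ TG v)
  pendant-image-adj = Equivalence.from (T-adj TG _ _) (images-distinct , u , v , refl , refl , uv)
    where
    images-distinct : φ TG u ≢ φ TG v
    images-distinct e = adj-irrefl G uv (≡.sym (pendant-fibre (≡.sym e)))

  pendant-image-neighbour : ∀ {y} → Adj (T TG) (φ TG u) y → y ≡ φ TG v
  pendant-image-neighbour {y} a with Equivalence.to (T-adj TG _ y) a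
  ... | _ , x , w , φx≡φu , refl , xw with pendant-fibre φx≡φu
  ... | refl = cong (φ TG) (pendant-unique-neighbour G pen xw uv)

endpoints-All : ∀ {m} {Q : Fin m → Set} (M : List (Fin m × Fin m)) →
  All (λ p → Q (proj₁ p) × Q (proj₂ p)) M → All Q (endpoints M)
endpoints-All []            []              = []
endpoints-All ((x , y) ∷ M) ((qx , qy) ∷ qM) = qx ∷ qy ∷ endpoints-All M qM

-- Let bc be an edge of H with c ∉ P and no neighbour of b in P.  Then a
-- matching of the subgraph induced by P avoids b and c, so adding bc gives
-- a matching of H.
extend-matching : ∀ {m} (H : Graph m) {P : Fin m → Set} {M} {b c : Fin m} →
  IsMatching H P M → Adj H b c → ¬ P c → (∀ {y} → Adj H b y → ¬ P y) →
  IsMatching H Everything ((b , c) ∷ M)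
extend-matching H {P} {M} {b} {c} (edges , unique) bc ¬Pc ¬P-nb =
  (bc , tt , tt) ∷ All.map (λ { {_ , _} (xy , _ , _) → xy , tt , tt }) edges ,
  (adj-irrefl H bc ∷ All.map proj₁ free) ∷ All.map proj₂ free ∷ unique
  where
  Free : Fin _ → Set
  Free z = b ≢ z × c ≢ z

  both-ends-free : ∀ {x y} → Adj H x y × P x × P y → Free x × Free y
  both-ends-free (xy , Px , Py) =
    ((λ { refl → ¬P-nb xy Py }) , (λ { refl → ¬Pc Px })) ,
    ((λ { refl → ¬P-nb (adj-sym H xy) Px }) , (λ { refl → ¬Pc Py }))

  free : All Free (endpoints M)
  free = endpoints-All M (All.map (λ { {_ , _} → both-ends-free }) edges)

matching-number-gap : ∀ {m} (H : Graph m) {P : Fin m → Set} {t : ℕ} {b c : Fin m} →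
  MatchingNumber H Everything t → MatchingNumber H P t →
  Adj H b c → ¬ P c → (∀ {y} → Adj H b y → ¬ P y) → ⊥
matching-number-gap H (_ , maximal) ((M , isM , refl) , _) bc ¬Pc ¬P-nb =
  n≮n (length M) (maximal _ (extend-matching H isM bc ¬Pc ¬P-nb))

lemma2p15 : ∀ {n} (G̃ : MixedGraph n) →
    CyclesVertexDisjoint (underlying G̃) →
    (TG : CycleContraction (underlying G̃)) →
    (∃[ t ] (MatchingNumber (T TG) Everything t ×
             MatchingNumber (T TG) (λ a → ¬ Contracted TG a) t)) →
    ∀ (C : Cycle (underlying G̃)) v → OnCycle C v →
    ¬ QuasiPendant (underlying G̃) v
lemma2p15 G̃ _ TG (_ , m[T] , m[T∖contracted]) C v onC (u , vu , pen) =
  matching-number-gap (T TG) m[T] m[T∖contracted]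
    (pendant-image-adj TG pen uv)
    (λ ¬contracted → ¬contracted φv-contracted)
    (λ by ¬contracted →
       ¬contracted (subst (Contracted TG) (≡.sym (pendant-image-neighbour TG pen uv by))
                          φv-contracted))
  where
  uv : Adj (underlying G̃) u v
  uv = adj-sym (underlying G̃) vu

  φv-contracted : Contracted TG (φ TG v)
  φv-contracted = C , v , onC , refl
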